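{- If $r$ is a rotor type with two states, then $|UD(r)|\le \frac{|r|^2}{2}$ and $|BT(r)|\le |r|^2$.
   Context: A rotor type is an infinite periodic sequence $r=(r^{(1)},r^{(2)},\dots)$ of natural numbers (states), with (fundamental) period $|r|$. A two-state rotor type is written over the states $\{1,2\}$ with the convention $r^{(1)}=1$. A rotor-router network: a finite digraph, a source vertex, target vertices of outdegree $0$, and at each non-target vertex $v$ a periodic sequence $e_v^{(1)},e_v^{(2)},\dots$ of out-edges; a particle starts at the source, on its $n$-th visit to a non-target vertex $v$ leaves along $e_v^{(n)}$, and whenever it reaches a target it is returned to the source; the hitting sequence is the (periodic) sequence of targets reached, and its length $|\cdot|$ is its period. The compressor network $UD$ for $r$ has non-target vertices $1$ (source), $2,3$ and targets $4,5$; on the $n$-th departure: from vertex $1$ the particle goes to vertex $2$ if $r^{(n)}=1$ and to vertex $3$ if $r^{(n)}=2$; from vertex $2$ it goes to vertex $1$ if $r^{(n)}=1$ and to target $4$ if $r^{(n)}=2$; from vertex $3$ it goes to target $5$ if $r^{(n)}=1$ and to vertex $1$ if $r^{(n)}=2$. $UD(r)$ is its hitting sequence. $BT(r)$ is the hitting sequence of the binary tree network: source vertex $1$ whose $n$-th departure goes to vertex $2$ or $3$ according as $r^{(n)}=1$ or $2$, and vertices $2$ and $3$ each having two distinct target out-neighbours (four targets in total), the $n$-th departure from each of them going to one or the other of its targets according to $r^{(n)}$. -}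

module Defs where

open import Data.Nat using (ℕ; zero; suc; _+_; _*_; _≤_)
open import Data.Fin using (Fin; zero; suc; _≟_)
open import Data.Product using (_×_; _,_; proj₁; proj₂; ∃; ∃-syntax)
open import Data.Sum using (_⊎_; inj₁; inj₂)
open import Data.Maybe using (Maybe; just; nothing)
open import Relation.Nullary using (yes; no)
open import Relation.Binary.PropositionalEquality using (_≡_)
open import Function.Bundles using (_⇔_)

data State : Set where
  s₁ s₂ : State

-- Rotor types are infinite sequences; we index them from 0,
-- so  r n  is  r^(n+1)  in the paper's notation.
RotorSeq : Set
RotorSeq = ℕ → State

-- p is a period of a "sequence" given as a relation H k a  ("the k-th term is a").
-- (Relations are used so that hitting sequences, defined by simulation, fit too.)
IsPeriodRel : {A : Set} → (ℕ → A → Set) → ℕ → Set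
IsPeriodRel {A} H p = ∀ (k : ℕ) (a : A) → H k a ⇔ H (k + p) a

IsFundPeriodRel : {A : Set} → (ℕ → A → Set) → ℕ → Set
IsFundPeriodRel H p =
  1 ≤ p × IsPeriodRel H p × (∀ q → 1 ≤ q → IsPeriodRel H q → p ≤ q)

SeqRel : {A : Set} → (ℕ → A) → ℕ → A → Set
SeqRel f k a = f k ≡ a

TwoStateRotor : RotorSeq → ℕ → Set
TwoStateRotor r L =
  r 0 ≡ s₁ × IsFundPeriodRel (SeqRel r) L × (∃[ n ] r n ≡ s₂)

-- A rotor-router network with m non-target vertices (source = zero)
-- and t targets, where every non-target vertex uses the same rotor type:
-- out v s  is where the particle goes when leaving v while the rotor state is s.
Network : ℕ → ℕ → Set
Network m t = Fin m → State → Fin m ⊎ Fin t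

module Run {m t : ℕ} (N : Network (suc m) t) (r : RotorSeq) where

  -- current vertex and number of previous departures from each vertex
  Config : Set
  Config = Fin (suc m) × (Fin (suc m) → ℕ)

  incr : (Fin (suc m) → ℕ) → Fin (suc m) → Fin (suc m) → ℕ
  incr c v u with u ≟ v
  ... | yes _ = suc (c u)
  ... | no _  = c u

  -- one move of the particle; the (c v + 1)-th departure from v uses r^(c v + 1).
  -- Reaching a target emits it and returns the particle to the source.
  step : Config → Config × Maybe (Fin t)
  step (v , c) with N v (r (c v))
  ... | inj₁ w = (w , incr c v) , nothing
  ... | inj₂ τ = (zero , incr c v) , just τ

  run : ℕ → Config
  run zero    = zero , (λ _ → 0)
  run (suc n) = proj₁ (step (run n))

  emit : ℕ → Maybe (Fin t)
  emit n = proj₂ (step (run n))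

  isHit : Maybe (Fin t) → ℕ
  isHit (just _) = 1
  isHit nothing  = 0

  hitsBefore : ℕ → ℕ
  hitsBefore zero    = 0
  hitsBefore (suc n) = hitsBefore n + isHit (emit n)

  -- Hit k τ : the k-th (0-indexed) target reached is τ.
  Hit : ℕ → Fin t → Set
  Hit k τ = ∃[ n ] (hitsBefore n ≡ k × emit n ≡ just τ)

HitSeq : {m t : ℕ} → Network (suc m) t → RotorSeq → ℕ → Fin t → Set
HitSeq N r = Run.Hit N r

-- Vertices 1,2,3 are zero, suc zero, suc (suc zero); targets 4,5 are zero, suc zero of Fin 2.
UDnet : Network 3 2
UDnet zero s₁ = inj₁ (suc zero)
UDnet zero s₂ = inj₁ (suc (suc zero))
UDnet (suc zero) s₁ = inj₁ zero
UDnet (suc zero) s₂ = inj₂ zero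
UDnet (suc (suc zero)) s₁ = inj₂ (suc zero)
UDnet (suc (suc zero)) s₂ = inj₁ zero

-- Binary tree: vertex 2 has targets 0,1 and vertex 3 has targets 2,3 (of Fin 4).
BTnet : Network 3 4
BTnet zero s₁ = inj₁ (suc zero)
BTnet zero s₂ = inj₁ (suc (suc zero))
BTnet (suc zero) s₁ = inj₂ zero
BTnet (suc zero) s₂ = inj₂ (suc zero)
BTnet (suc (suc zero)) s₁ = inj₂ (suc (suc zero))
BTnet (suc (suc zero)) s₂ = inj₂ (suc (suc (suc zero)))

UD : RotorSeq → ℕ → Fin 2 → Set
UD = HitSeq UDnet

BT : RotorSeq → ℕ → Fin 4 → Set
BT = HitSeq BTnet

-- In both networks vertices 2 and 3 hand the particle back to the source or to a target, so
-- the run splits into rounds of two moves; in round n the source is in state r n and the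
-- chosen child in state r (#ᵢ n), where #ᵢ n counts the earlier occurrences of state i in r.
-- These data have period |r|², so the target sequence is periodic with period the number K of
-- hits in |r|² rounds, and its least period is at most K.  In BT every round hits, so
-- K = |r|²; in UD a change of summation variable gives K = 2ab, where a and b count the
-- states 1 and 2 in a period of r, and 4ab ≤ (a + b)² = |r|².

module Submission where

open import Defs
open import Data.Nat using (ℕ; zero; suc; _+_; _*_; _≤_; _<_; _≤′_; ≤′-refl; ≤′-step; z≤n; s≤s; s≤s⁻¹; _≤?_; _<?_; NonZero; >-nonZero)
open import Data.Nat.Properties
open import Data.Nat.DivMod using (_%_; _/_; m%n<n; m≡m%n+[m/n]*n)
open import Data.Nat.Induction using (<-rec)
open import Data.Nat.Tactic.RingSolver using (solve-∀)
open import Data.Fin using (Fin; zero; suc)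
import Data.Fin as Fin
open import Data.Product using (_×_; _,_; proj₁; proj₂; ∃-syntax)
open import Data.Sum using (_⊎_; inj₁; inj₂)
open import Data.Maybe using (Maybe; just; nothing)
open import Data.Maybe.Properties using (just-injective)
open import Data.Empty using (⊥; ⊥-elim)
open import Data.Unit using (⊤; tt)
open import Function using (_∘_)
open import Relation.Nullary using (yes; no)
open import Relation.Nullary.Decidable using (map′; _×-dec_)
open import Relation.Unary using (Decidable)
open import Relation.Binary.Definitions using (DecidableEquality; tri<; tri≈; tri>)
open import Relation.Binary.PropositionalEquality
open import Function.Bundles using (_⇔_; Equivalence; mk⇔)
open import Function.Construct.Composition using (_⇔-∘_)
open import Function.Construct.Symmetry using (⇔-sym)
open import Algebra.Properties.CommutativeSemigroup +-commutativeSemigroup renaming (interchange to +-interchange)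

sumUpTo : (ℕ → ℕ) → ℕ → ℕ
sumUpTo g zero    = 0
sumUpTo g (suc n) = g n + sumUpTo g n

sumUpTo-cong : ∀ {g h} → g ≗ h → sumUpTo g ≗ sumUpTo h
sumUpTo-cong g≗h zero    = refl
sumUpTo-cong g≗h (suc n) = cong₂ _+_ (g≗h n) (sumUpTo-cong g≗h n)

sumUpTo-+ : ∀ g h n → sumUpTo (λ i → g i + h i) n ≡ sumUpTo g n + sumUpTo h n
sumUpTo-+ g h zero    = refl
sumUpTo-+ g h (suc n) = trans (cong (g n + h n +_) (sumUpTo-+ g h n)) (+-interchange (g n) (h n) _ _)

sumUpTo-const : ∀ c n → sumUpTo (λ _ → c) n ≡ n * c
sumUpTo-const c zero    = refl
sumUpTo-const c (suc n) = cong (c +_) (sumUpTo-const c n)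

sumUpTo-monoʳ-≤ : ∀ g {m n} → m ≤ n → sumUpTo g m ≤ sumUpTo g n
sumUpTo-monoʳ-≤ g = mono ∘ ≤⇒≤′
  where
  mono : ∀ {m n} → m ≤′ n → sumUpTo g m ≤ sumUpTo g n
  mono ≤′-refl        = ≤-refl
  mono (≤′-step m≤′n) = ≤-trans (mono m≤′n) (m≤n+m _ _)

term≤sumUpTo : ∀ g {i n} → i < n → g i ≤ sumUpTo g n
term≤sumUpTo g {i} i<n = ≤-trans (m≤m+n (g i) _) (sumUpTo-monoʳ-≤ g i<n)

-- Substitution along the counting function of a 0/1-valued g.
sumUpTo-reindex : ∀ {g} → (∀ i → g i ≤ 1) → ∀ f n →
  sumUpTo (λ i → g i * f (sumUpTo g i)) n ≡ sumUpTo f (sumUpTo g n)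
sumUpTo-reindex         g≤1 f zero = refl
sumUpTo-reindex {g} g≤1 f (suc n) with g n | g≤1 n
... | 0 | _ = sumUpTo-reindex g≤1 f n
... | 1 | _ = cong₂ _+_ (+-identityʳ _) (sumUpTo-reindex g≤1 f n)
... | suc (suc _) | s≤s ()

Periodic : {A : Set} → (ℕ → A) → ℕ → Set
Periodic f p = ∀ k → f (k + p) ≡ f k

sumUpTo-shift : ∀ {g L} → Periodic g L → ∀ n → sumUpTo g (n + L) ≡ sumUpTo g n + sumUpTo g L
sumUpTo-shift gL zero    = refl
sumUpTo-shift {g} {L} gL (suc n) =
  trans (cong₂ _+_ (gL n) (sumUpTo-shift gL n)) (sym (+-assoc (g n) (sumUpTo g n) (sumUpTo g L)))

sumUpTo-periodic : ∀ {g L} → Periodic g L → ∀ m n → sumUpTo g (n + m * L) ≡ sumUpTo g n + m * sumUpTo g L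
sumUpTo-periodic {g}     gL zero    n = trans (cong (sumUpTo g) (+-identityʳ n)) (sym (+-identityʳ _))
sumUpTo-periodic {g} {L} gL (suc m) n = begin
  sumUpTo g (n + (L + m * L))                  ≡⟨ cong (sumUpTo g) (+-rearrange n L (m * L)) ⟩
  sumUpTo g (n + m * L + L)                    ≡⟨ sumUpTo-shift gL (n + m * L) ⟩
  sumUpTo g (n + m * L) + sumUpTo g L          ≡⟨ cong (_+ sumUpTo g L) (sumUpTo-periodic gL m n) ⟩
  sumUpTo g n + m * sumUpTo g L + sumUpTo g L  ≡⟨ +-rearrange′ (sumUpTo g n) (m * sumUpTo g L) (sumUpTo g L) ⟩
  sumUpTo g n + (sumUpTo g L + m * sumUpTo g L) ∎
  where
  open ≡-Reasoning
  +-rearrange : ∀ a b c → a + (b + c) ≡ a + c + b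
  +-rearrange = solve-∀
  +-rearrange′ : ∀ a b c → a + b + c ≡ a + (c + b)
  +-rearrange′ = solve-∀

sumUpTo-* : ∀ {g L} → Periodic g L → ∀ m → sumUpTo g (m * L) ≡ m * sumUpTo g L
sumUpTo-* gL m = sumUpTo-periodic gL m 0

sumUpTo-nested : ∀ {g h L} → Periodic g L → Periodic h L →
  sumUpTo h (sumUpTo g (L * L)) ≡ sumUpTo g L * sumUpTo h L
sumUpTo-nested {g} {h} {L} gL hL = begin
  sumUpTo h (sumUpTo g (L * L))  ≡⟨ cong (sumUpTo h) (sumUpTo-* gL L) ⟩
  sumUpTo h (L * sumUpTo g L)    ≡⟨ cong (sumUpTo h) (*-comm L _) ⟩
  sumUpTo h (sumUpTo g L * L)    ≡⟨ sumUpTo-* hL (sumUpTo g L) ⟩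
  sumUpTo g L * sumUpTo h L      ∎
  where open ≡-Reasoning

module _ {A : Set} {f : ℕ → A} where

  periodic-+ : ∀ {p q} → Periodic f p → Periodic f q → Periodic f (p + q)
  periodic-+ {p} {q} fp fq k = trans (cong f (sym (+-assoc k p q))) (trans (fq (k + p)) (fp k))

  periodic-* : ∀ {p} → Periodic f p → ∀ m → Periodic f (m * p)
  periodic-* fp zero    k = cong f (+-identityʳ k)
  periodic-* fp (suc m)   = periodic-+ fp (periodic-* fp m)

  periodic-sumUpTo : ∀ {g L p} → Periodic g L → Periodic f p → Periodic (f ∘ sumUpTo g) (p * L)
  periodic-sumUpTo {g} {L} {p} gL fp n = begin
    f (sumUpTo g (n + p * L))          ≡⟨ cong f (sumUpTo-periodic gL p n) ⟩
    f (sumUpTo g n + p * sumUpTo g L)  ≡⟨ cong (λ x → f (sumUpTo g n + x)) (*-comm p _) ⟩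
    f (sumUpTo g n + sumUpTo g L * p)  ≡⟨ periodic-* fp (sumUpTo g L) (sumUpTo g n) ⟩
    f (sumUpTo g n)                    ∎
    where open ≡-Reasoning

  periodic-% : ∀ {p} .{{_ : NonZero p}} → Periodic f p → ∀ n → f n ≡ f (n % p)
  periodic-% {p} fp n = trans (cong f (m≡m%n+[m/n]*n n p)) (periodic-* fp (n / p) (n % p))

  periodic⇒isPeriod : ∀ {q} → Periodic f q → IsPeriodRel (SeqRel f) q
  periodic⇒isPeriod fq k a = mk⇔ (trans (fq k)) (trans (sym (fq k)))

  isPeriod⇒periodic : ∀ {q} → IsPeriodRel (SeqRel f) q → Periodic f q
  isPeriod⇒periodic pr k = Equivalence.to (pr k (f k)) refl

  periodic-fromBelow : ∀ {K q} → Periodic f K → 0 < K →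
    (∀ {k} → k < K → f (k + q) ≡ f k) → Periodic f q
  periodic-fromBelow {K} {q} fK 0<K below = <-rec _ shift
    where
    shift : ∀ k → (∀ {j} → j < k → f (j + q) ≡ f j) → f (k + q) ≡ f k
    shift k ih with k <? K
    ... | yes k<K = below k<K
    ... | no  k≮K with m≤n⇒∃[o]m+o≡n (≮⇒≥ k≮K)
    ...   | o , refl = begin
      f (K + o + q)  ≡⟨ cong f (+-rearrange K o q) ⟩
      f (o + q + K)  ≡⟨ fK (o + q) ⟩
      f (o + q)      ≡⟨ ih (m<n+m o 0<K) ⟩
      f o            ≡⟨ fK o ⟨
      f (o + K)      ≡⟨ cong f (+-comm o K) ⟩
      f (K + o)      ∎
      where
      open ≡-Reasoning
      +-rearrange : ∀ a b c → a + b + c ≡ b + c + a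
      +-rearrange = solve-∀

  periodic? : DecidableEquality A → ∀ {K} → Periodic f K → 0 < K → Decidable (Periodic f)
  periodic? _≟_ {K} fK 0<K q =
    map′ (periodic-fromBelow fK 0<K) (λ fq {k} _ → fq k)
         (allUpTo? {P = λ k → f (k + q) ≡ f k} (λ k → f (k + q) ≟ f k) K)

∃-least : ∀ {P : ℕ → Set} → Decidable P → ∀ {w} → P w →
  ∃[ m ] (P m × m ≤ w × (∀ {n} → P n → m ≤ n))
∃-least {P} P? {w} = <-rec (λ w → P w → ∃[ m ] (P m × m ≤ w × (∀ {n} → P n → m ≤ n))) search w
  where
  search : ∀ w → (∀ {v} → v < w → P v → ∃[ m ] (P m × m ≤ v × (∀ {n} → P n → m ≤ n))) →
    P w → ∃[ m ] (P m × m ≤ w × (∀ {n} → P n → m ≤ n))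
  search w ih Pw with anyUpTo? P? w
  ... | yes (v , v<w , Pv) with ih v<w Pv
  ...   | m , Pm , m≤v , least = m , Pm , ≤-trans m≤v (<⇒≤ v<w) , least
  search w ih Pw | no none = w , Pw , ≤-refl , λ {n} Pn → ≮⇒≥ (λ n<w → none (n , n<w , Pn))

fundamentalPeriod : ∀ {A : Set} → DecidableEquality A → ∀ {f : ℕ → A} {K} → Periodic f K → 0 < K →
  ∃[ p ] (IsFundPeriodRel (SeqRel f) p × p ≤ K)
fundamentalPeriod _≟_ fK 0<K with ∃-least (λ q → (1 ≤? q) ×-dec periodic? _≟_ fK 0<K q) (0<K , fK)
... | p , (0<p , fp) , p≤K , least =
  p , (0<p , periodic⇒isPeriod fp , λ q 0<q pq → least (0<q , isPeriod⇒periodic pq)) , p≤K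

isPeriod-resp-⇔ : ∀ {A : Set} {R S : ℕ → A → Set} → (∀ k a → R k a ⇔ S k a) →
  ∀ {q} → IsPeriodRel S q → IsPeriodRel R q
isPeriod-resp-⇔ R⇔S {q} Sq k a = ⇔-sym (R⇔S (k + q) a) ⇔-∘ (Sq k a ⇔-∘ R⇔S k a)

isFundPeriod-resp-⇔ : ∀ {A : Set} {R S : ℕ → A → Set} → (∀ k a → R k a ⇔ S k a) →
  ∀ {p} → IsFundPeriodRel S p → IsFundPeriodRel R p
isFundPeriod-resp-⇔ R⇔S (0<p , Sp , least) =
  0<p , isPeriod-resp-⇔ R⇔S Sp , λ q 0<q Rq → least q 0<q (isPeriod-resp-⇔ (λ k a → ⇔-sym (R⇔S k a)) Rq)

module _ {A : Set} where

  hitIndicator : Maybe A → ℕ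
  hitIndicator (just _) = 1
  hitIndicator nothing  = 0

  #hits : (ℕ → Maybe A) → ℕ → ℕ
  #hits e = sumUpTo (hitIndicator ∘ e)

  Hits : (ℕ → Maybe A) → ℕ → A → Set
  Hits e k a = ∃[ n ] (#hits e n ≡ k × e n ≡ just a)

module _ {A : Set} {e : ℕ → Maybe A} where

  #hits-<-after : ∀ {n n' a} → e n ≡ just a → n < n' → #hits e n < #hits e n'
  #hits-<-after {n} en n<n' =
    ≤-trans (≤-reflexive (cong (λ x → hitIndicator x + #hits e n) (sym en))) (sumUpTo-monoʳ-≤ _ n<n')

  Hits-functional : ∀ {k a b} → Hits e k a → Hits e k b → a ≡ b
  Hits-functional (n , hn , en) (n' , hn' , en') with <-cmp n n'
  ... | tri< n<n' _ _ = ⊥-elim (<-irrefl (trans hn (sym hn')) (#hits-<-after en n<n'))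
  ... | tri≈ _ refl _ = just-injective (trans (sym en) en')
  ... | tri> _ _ n'<n = ⊥-elim (<-irrefl (trans hn' (sym hn)) (#hits-<-after en' n'<n))

  Hits-below : ∀ N {k} → k < #hits e N → ∃[ a ] Hits e k a
  Hits-below (suc N) {k} k<  with k <? #hits e N
  ... | yes k<N = Hits-below N k<N
  ... | no  k≮N with e N in eN
  ...   | just a  = a , N , ≤-antisym (≮⇒≥ k≮N) (s≤s⁻¹ k<) , eN
  ...   | nothing = ⊥-elim (k≮N k<)

module PeriodicEmission {A : Set} {e : ℕ → Maybe A} {P : ℕ} (eP : Periodic e P) (0<K : 0 < #hits e P) where

  K : ℕ
  K = #hits e P

  Hits-shift : ∀ {k a} → Hits e k a → Hits e (k + K) a
  Hits-shift (n , refl , en) = n + P , sumUpTo-shift (cong hitIndicator ∘ eP) n , trans (eP n) en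

  Hits-total : ∀ k → ∃[ a ] Hits e k a
  Hits-total k = Hits-below (suc k * P) (≤-trans (m≤m*n (suc k) K) (≤-reflexive (sym #hits-multiple)))
    where
    instance _ = >-nonZero 0<K
    #hits-multiple : #hits e (suc k * P) ≡ suc k * K
    #hits-multiple = sumUpTo-* (cong hitIndicator ∘ eP) (suc k)

  nthHit : ℕ → A
  nthHit k = proj₁ (Hits-total k)

  Hits⇔nthHit : ∀ k a → Hits e k a ⇔ SeqRel nthHit k a
  Hits⇔nthHit k a = mk⇔ (Hits-functional (proj₂ (Hits-total k))) (λ { refl → proj₂ (Hits-total k) })

  nthHit-periodic : Periodic nthHit K
  nthHit-periodic k = Hits-functional (proj₂ (Hits-total (k + K))) (Hits-shift (proj₂ (Hits-total k)))

  Hits-fundamentalPeriod : DecidableEquality A → ∃[ p ] (IsFundPeriodRel (Hits e) p × p ≤ K)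
  Hits-fundamentalPeriod _≟_ =
    let p , fp , p≤K = fundamentalPeriod _≟_ nthHit-periodic 0<K
    in  p , isFundPeriod-resp-⇔ Hits⇔nthHit fp , p≤K

double : ℕ → ℕ
double zero    = zero
double (suc n) = suc (suc (double n))

double⊎suc-double : ∀ n → ∃[ m ] (n ≡ double m ⊎ n ≡ suc (double m))
double⊎suc-double zero = 0 , inj₁ refl
double⊎suc-double (suc n) with double⊎suc-double n
... | m , inj₁ refl = m , inj₂ refl
... | m , inj₂ refl = suc m , inj₁ refl

module _ {A : Set} {e e' : ℕ → Maybe A}
         (even : ∀ n → e (double n) ≡ nothing) (odd : ∀ n → e (suc (double n)) ≡ e' n) where

  #hits-double : ∀ n → #hits e (double n) ≡ #hits e' n
  #hits-double zero    = refl
  #hits-double (suc n) = cong₂ _+_ (cong hitIndicator (odd n))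
    (trans (cong (λ x → hitIndicator x + #hits e (double n)) (even n)) (#hits-double n))

  #hits-suc-double : ∀ n → #hits e (suc (double n)) ≡ #hits e' n
  #hits-suc-double n = trans (cong (λ x → hitIndicator x + #hits e (double n)) (even n)) (#hits-double n)

  Hits-interleave : ∀ k a → Hits e k a ⇔ Hits e' k a
  Hits-interleave k a = mk⇔ to from
    where
    to : Hits e k a → Hits e' k a
    to (n , hn , en) with double⊎suc-double n
    ... | m , inj₁ refl with () ← trans (sym (even m)) en
    ... | m , inj₂ refl = m , trans (sym (#hits-suc-double m)) hn , trans (sym (odd m)) en
    from : Hits e' k a → Hits e k a
    from (m , hm , em) = suc (double m) , trans (#hits-suc-double m) hm , trans (odd m) em


am-gm-≤ : ∀ {m n} → m ≤ n → 2 * (m * n + n * m) ≤ (m + n) * (m + n)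
am-gm-≤ {m} m≤n with m≤n⇒∃[o]m+o≡n m≤n
... | d , refl = subst (2 * (m * (m + d) + (m + d) * m) ≤_) (sym (square-expand m d)) (m≤m+n _ (d * d))
  where
  square-expand : ∀ m d → (m + (m + d)) * (m + (m + d)) ≡ 2 * (m * (m + d) + (m + d) * m) + d * d
  square-expand = solve-∀

am-gm : ∀ m n → 2 * (m * n + n * m) ≤ (m + n) * (m + n)
am-gm m n with ≤-total m n
... | inj₁ m≤n = am-gm-≤ m≤n
... | inj₂ n≤m = subst₂ _≤_ (cong (2 *_) (+-comm (n * m) (m * n))) (cong (λ x → x * x) (+-comm n m)) (am-gm-≤ n≤m)

outcome : ∀ {m t} → Fin m ⊎ Fin t → Maybe (Fin t)
outcome (inj₁ _) = nothing
outcome (inj₂ τ) = just τ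

EndsRound : ∀ {m t} → Fin (suc m) ⊎ Fin t → Set
EndsRound (inj₁ zero)    = ⊤
EndsRound (inj₁ (suc _)) = ⊥
EndsRound (inj₂ _)       = ⊤

module RunProperties {m t : ℕ} (N : Network (suc m) t) (r : RotorSeq) where
  open Run N r

  step-forward : ∀ {v c w} → N v (r (c v)) ≡ inj₁ w → step (v , c) ≡ ((w , incr c v) , nothing)
  step-forward eq rewrite eq = refl

  step-ending : ∀ v c → EndsRound (N v (r (c v))) →
    step (v , c) ≡ ((zero , incr c v) , outcome (N v (r (c v))))
  step-ending v c ends with N v (r (c v))
  ... | inj₁ zero = refl
  ... | inj₂ τ    = refl
  step-ending v c () | inj₁ (suc _)

  incr-cong : ∀ {c c'} → c ≗ c' → ∀ v → incr c v ≗ incr c' v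
  incr-cong c≗c' v u with u Fin.≟ v
  ... | yes _ = cong suc (c≗c' u)
  ... | no  _ = c≗c' u

  hitsBefore≡#hits : ∀ n → hitsBefore n ≡ #hits emit n
  hitsBefore≡#hits zero    = refl
  hitsBefore≡#hits (suc n) =
    trans (+-comm (hitsBefore n) _) (cong₂ _+_ (isHit≡hitIndicator (emit n)) (hitsBefore≡#hits n))
    where
    isHit≡hitIndicator : ∀ x → isHit x ≡ hitIndicator x
    isHit≡hitIndicator (just _) = refl
    isHit≡hitIndicator nothing  = refl

  HitSeq⇔Hits : ∀ k τ → HitSeq N r k τ ⇔ Hits emit k τ
  HitSeq⇔Hits k τ = mk⇔ (λ (n , hn , en) → n , trans (sym (hitsBefore≡#hits n)) hn , en)
                        (λ (n , hn , en) → n , trans (hitsBefore≡#hits n) hn , en)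

child : State → Fin 3
child s₁ = suc zero
child s₂ = suc (suc zero)

ind₁ ind₂ : State → ℕ
ind₁ s₁ = 1
ind₁ s₂ = 0
ind₂ s₁ = 0
ind₂ s₂ = 1

ind₁≤1 : ∀ s → ind₁ s ≤ 1
ind₁≤1 s₁ = ≤-refl
ind₁≤1 s₂ = z≤n

ind₂≤1 : ∀ s → ind₂ s ≤ 1
ind₂≤1 s₁ = z≤n
ind₂≤1 s₂ = ≤-refl

ind₁+ind₂≡1 : ∀ s → ind₁ s + ind₂ s ≡ 1
ind₁+ind₂≡1 s₁ = refl
ind₁+ind₂≡1 s₂ = refl

#₁ #₂ : RotorSeq → ℕ → ℕ
#₁ r = sumUpTo (ind₁ ∘ r)
#₂ r = sumUpTo (ind₂ ∘ r)

#₁+#₂≡id : ∀ r n → #₁ r n + #₂ r n ≡ n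
#₁+#₂≡id r n = begin
  #₁ r n + #₂ r n                                 ≡⟨ sumUpTo-+ (ind₁ ∘ r) (ind₂ ∘ r) n ⟨
  sumUpTo (λ i → ind₁ (r i) + ind₂ (r i)) n       ≡⟨ sumUpTo-cong (ind₁+ind₂≡1 ∘ r) n ⟩
  sumUpTo (λ _ → 1) n                             ≡⟨ sumUpTo-const 1 n ⟩
  n * 1                                           ≡⟨ *-identityʳ n ⟩
  n                                               ∎
  where open ≡-Reasoning

module TwoLevel {t : ℕ} (N : Network 3 t) (N-source : ∀ s → N zero s ≡ inj₁ (child s))
                (N-child : ∀ s s' → EndsRound (N (child s) s')) (r : RotorSeq) where
  open Run N r
  open RunProperties N r

  visits : ℕ → Fin 3 → ℕ
  visits zero    _ = 0
  visits (suc n)   = incr (incr (visits n) zero) (child (r n))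

  visits-source : ∀ n → visits n zero ≡ n
  visits-source zero = refl
  visits-source (suc n) with r n
  ... | s₁ = cong suc (visits-source n)
  ... | s₂ = cong suc (visits-source n)

  visits-child₁ : ∀ n → visits n (child s₁) ≡ #₁ r n
  visits-child₁ zero = refl
  visits-child₁ (suc n) with r n
  ... | s₁ = cong suc (visits-child₁ n)
  ... | s₂ = visits-child₁ n

  visits-child₂ : ∀ n → visits n (child s₂) ≡ #₂ r n
  visits-child₂ zero = refl
  visits-child₂ (suc n) with r n
  ... | s₁ = visits-child₂ n
  ... | s₂ = cong suc (visits-child₂ n)

  incr-source-child : ∀ c s → incr c zero (child s) ≡ c (child s)
  incr-source-child c s₁ = refl
  incr-source-child c s₂ = refl

  roundEmission : State → State → State → Maybe (Fin t)
  roundEmission s₁ x _ = outcome (N (child s₁) x)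
  roundEmission s₂ _ y = outcome (N (child s₂) y)

  -- In round n the source is in state r n, and the child it chooses, leaving for the
  -- (#ᵢ r n + 1)-th time, is in state r (#ᵢ r n).
  roundEmissions : ℕ → Maybe (Fin t)
  roundEmissions n = roundEmission (r n) (r (#₁ r n)) (r (#₂ r n))

  emission-child : ∀ s {n i} → i ≡ visits n (child s) →
    outcome (N (child s) (r i)) ≡ roundEmission s (r (#₁ r n)) (r (#₂ r n))
  emission-child s₁ {n} refl = cong (λ i → outcome (N (child s₁) (r i))) (visits-child₁ n)
  emission-child s₂ {n} refl = cong (λ i → outcome (N (child s₂) (r i))) (visits-child₂ n)

  AtSource : Config → ℕ → Set
  AtSource (v , c) n = v ≡ zero × c ≗ visits n

  round : ∀ n {cfg} → AtSource cfg n →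
      proj₂ (step cfg) ≡ nothing
    × proj₂ (step (proj₁ (step cfg))) ≡ roundEmissions n
    × AtSource (proj₁ (step (proj₁ (step cfg)))) (suc n)
  round n {v , c} (refl , c≗)
    rewrite step-forward {zero} {c} (trans (cong (N zero ∘ r) (trans (c≗ zero) (visits-source n))) (N-source (r n)))
          | step-ending (child (r n)) (incr c zero) (N-child (r n) _)
    = refl
    , emission-child (r n) {n} (trans (incr-source-child c (r n)) (c≗ _))
    , refl
    , incr-cong (incr-cong c≗ zero) (child (r n))

  run-double : ∀ n → AtSource (run (double n)) n
  run-double zero    = refl , λ _ → refl
  run-double (suc n) = proj₂ (proj₂ (round n (run-double n)))

  HitSeq⇔Hits-roundEmissions : ∀ k τ → HitSeq N r k τ ⇔ Hits roundEmissions k τ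
  HitSeq⇔Hits-roundEmissions k τ = Hits-interleave {e = emit} emit-double emit-suc-double k τ ⇔-∘ HitSeq⇔Hits k τ
    where
    emit-double : ∀ n → emit (double n) ≡ nothing
    emit-double n = proj₁ (round n (run-double n))
    emit-suc-double : ∀ n → emit (suc (double n)) ≡ roundEmissions n
    emit-suc-double n = proj₁ (proj₂ (round n (run-double n)))

  module _ {L : ℕ} (rL : Periodic r L) where

    roundEmissions-periodic : Periodic roundEmissions (L * L)
    roundEmissions-periodic n = trans
      (cong₂ (λ s x → roundEmission s x (r (#₂ r (n + L * L))))
             (periodic-* rL L n) (periodic-sumUpTo (cong ind₁ ∘ rL) rL n))
      (cong (roundEmission (r n) (r (#₁ r n))) (periodic-sumUpTo (cong ind₂ ∘ rL) rL n))

    HitSeq-fundamentalPeriod : 0 < #hits roundEmissions (L * L) →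
      ∃[ p ] (IsFundPeriodRel (HitSeq N r) p × p ≤ #hits roundEmissions (L * L))
    HitSeq-fundamentalPeriod 0<K =
      let p , fp , p≤K = PeriodicEmission.Hits-fundamentalPeriod roundEmissions-periodic 0<K Fin._≟_
      in  p , isFundPeriod-resp-⇔ HitSeq⇔Hits-roundEmissions fp , p≤K

UD-source : ∀ s → UDnet zero s ≡ inj₁ (child s)
UD-source s₁ = refl
UD-source s₂ = refl

UD-child : ∀ s s' → EndsRound (UDnet (child s) s')
UD-child s₁ s₁ = tt
UD-child s₁ s₂ = tt
UD-child s₂ s₁ = tt
UD-child s₂ s₂ = tt

BT-source : ∀ s → BTnet zero s ≡ inj₁ (child s)
BT-source s₁ = refl
BT-source s₂ = refl

BT-child : ∀ s s' → EndsRound (BTnet (child s) s')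
BT-child s₁ s₁ = tt
BT-child s₁ s₂ = tt
BT-child s₂ s₁ = tt
BT-child s₂ s₂ = tt

module _ (r : RotorSeq) {L : ℕ} (rL : Periodic r L) where

  module UDRounds = TwoLevel UDnet UD-source UD-child r
  module BTRounds = TwoLevel BTnet BT-source BT-child r

  UD-hitsPerPeriod : #hits UDRounds.roundEmissions (L * L) ≡ #₁ r L * #₂ r L + #₂ r L * #₁ r L
  UD-hitsPerPeriod = begin
    #hits roundEmissions (L * L)
      ≡⟨ sumUpTo-cong (λ i → hitIndicator-roundEmission (r i) _ _) (L * L) ⟩
    sumUpTo (λ i → ind₁ (r i) * ind₂ (r (#₁ r i)) + ind₂ (r i) * ind₁ (r (#₂ r i))) (L * L)
      ≡⟨ sumUpTo-+ _ _ (L * L) ⟩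
    sumUpTo (λ i → ind₁ (r i) * ind₂ (r (#₁ r i))) (L * L) + sumUpTo (λ i → ind₂ (r i) * ind₁ (r (#₂ r i))) (L * L)
      ≡⟨ cong₂ _+_ (sumUpTo-reindex (ind₁≤1 ∘ r) (ind₂ ∘ r) (L * L)) (sumUpTo-reindex (ind₂≤1 ∘ r) (ind₁ ∘ r) (L * L)) ⟩
    #₂ r (#₁ r (L * L)) + #₁ r (#₂ r (L * L))
      ≡⟨ cong₂ _+_ (sumUpTo-nested (cong ind₁ ∘ rL) (cong ind₂ ∘ rL)) (sumUpTo-nested (cong ind₂ ∘ rL) (cong ind₁ ∘ rL)) ⟩
    #₁ r L * #₂ r L + #₂ r L * #₁ r L ∎
    where
    open ≡-Reasoning
    open UDRounds using (roundEmissions; roundEmission)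
    hitIndicator-roundEmission : ∀ s x y → hitIndicator (roundEmission s x y) ≡ ind₁ s * ind₂ x + ind₂ s * ind₁ y
    hitIndicator-roundEmission s₁ s₁ _ = refl
    hitIndicator-roundEmission s₁ s₂ _ = refl
    hitIndicator-roundEmission s₂ _ s₁ = refl
    hitIndicator-roundEmission s₂ _ s₂ = refl

  BT-hitsPerPeriod : #hits BTRounds.roundEmissions (L * L) ≡ L * L
  BT-hitsPerPeriod = begin
    #hits roundEmissions (L * L)  ≡⟨ sumUpTo-cong (λ i → hitIndicator-roundEmission (r i) _ _) (L * L) ⟩
    sumUpTo (λ _ → 1) (L * L)     ≡⟨ sumUpTo-const 1 (L * L) ⟩
    L * L * 1                     ≡⟨ *-identityʳ (L * L) ⟩
    L * L                         ∎
    where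
    open ≡-Reasoning
    open BTRounds using (roundEmissions; roundEmission)
    hitIndicator-roundEmission : ∀ s x y → hitIndicator (roundEmission s x y) ≡ 1
    hitIndicator-roundEmission s₁ s₁ _ = refl
    hitIndicator-roundEmission s₁ s₂ _ = refl
    hitIndicator-roundEmission s₂ _ s₁ = refl
    hitIndicator-roundEmission s₂ _ s₂ = refl

  UD-fundamentalPeriod : 0 < #₁ r L → 0 < #₂ r L → ∃[ p ] (IsFundPeriodRel (UD r) p × 2 * p ≤ L * L)
  UD-fundamentalPeriod 0<a 0<b =
    let p , fp , p≤K = UDRounds.HitSeq-fundamentalPeriod rL (subst (0 <_) (sym UD-hitsPerPeriod) 0<K)
    in  p , fp , (begin
      2 * p                                      ≤⟨ *-monoʳ-≤ 2 p≤K ⟩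
      2 * #hits UDRounds.roundEmissions (L * L)  ≡⟨ cong (2 *_) UD-hitsPerPeriod ⟩
      2 * (a * b + b * a)                        ≤⟨ am-gm a b ⟩
      (a + b) * (a + b)                          ≡⟨ cong (λ x → x * x) (#₁+#₂≡id r L) ⟩
      L * L                                      ∎)
    where
    open ≤-Reasoning
    a = #₁ r L
    b = #₂ r L
    0<K : 0 < a * b + b * a
    0<K = ≤-trans (*-mono-≤ 0<a 0<b) (m≤m+n _ _)

  BT-fundamentalPeriod : 0 < L → ∃[ q ] (IsFundPeriodRel (BT r) q × q ≤ L * L)
  BT-fundamentalPeriod 0<L =
    let q , fq , q≤K = BTRounds.HitSeq-fundamentalPeriod rL (subst (0 <_) (sym BT-hitsPerPeriod) (*-mono-≤ 0<L 0<L))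
    in  q , fq , subst (q ≤_) BT-hitsPerPeriod q≤K

corollary5p3 : ∀ (r : RotorSeq) (L : ℕ) → TwoStateRotor r L →
    (∃[ p ] (IsFundPeriodRel (UD r) p × 2 * p ≤ L * L))
    × (∃[ q ] (IsFundPeriodRel (BT r) q × q ≤ L * L))
corollary5p3 r L (r0≡s₁ , (0<L , isPeriod , _) , n , rn≡s₂) =
  UD-fundamentalPeriod r rL 0<#₁ 0<#₂ , BT-fundamentalPeriod r rL 0<L
  where
  instance _ = >-nonZero 0<L
  rL : Periodic r L
  rL = isPeriod⇒periodic isPeriod
  0<#₁ : 0 < #₁ r L
  0<#₁ = ≤-trans (≤-reflexive (cong ind₁ (sym r0≡s₁))) (term≤sumUpTo (ind₁ ∘ r) 0<L)
  0<#₂ : 0 < #₂ r L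
  0<#₂ = ≤-trans (≤-reflexive (cong ind₂ (sym (trans (sym (periodic-% rL n)) rn≡s₂))))
                 (term≤sumUpTo (ind₂ ∘ r) (m%n<n n L))
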